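{- A connected graph $G$ is unicyclic if and only if its universal cover $U^G$ contains exactly one infinite path (i.e. exactly one two-way infinite path subgraph).
   Context: A connected graph is unicyclic if it contains exactly one cycle. A covering map from a graph $K$ to a graph $G$ is a surjective homomorphism whose restriction to the neighborhood of each vertex of $K$ is a bijection onto the neighborhood of its image. The universal cover $U^G$ of a connected graph $G$ is the (unique up to isomorphism, possibly infinite) tree admitting a covering map onto $G$. -}

module Defs where

open import Data.Bool using (Bool; T)
open import Data.Nat using (ℕ; zero; suc; _≤_)
open import Data.Fin using (Fin; zero; suc; inject₁; fromℕ)
open import Data.Integer using (ℤ; _+_; 1ℤ)
open import Data.Product using (Σ; Σ-syntax; ∃; ∃-syntax; _×_; _,_)
open import Data.Sum using (_⊎_)
open import Relation.Binary.PropositionalEquality using (_≡_)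
open import Relation.Nullary using (¬_)
open import Function using (_⇔_)

-- A simple (possibly infinite) graph on vertex type V:
-- symmetric, irreflexive, Bool-valued adjacency (so adjacency is a proposition).
record Graph (V : Set) : Set where
  field
    adj     : V → V → Bool
    adj-sym : ∀ u v → T (adj u v) → T (adj v u)
    adj-irr : ∀ v → ¬ T (adj v v)

open Graph public

module _ {V : Set} (G : Graph V) where

  E : V → V → Set
  E u v = T (adj G u v)

  record Walk (k : ℕ) : Set where
    field
      vtx   : Fin (suc k) → V
      steps : ∀ (i : Fin k) → E (vtx (inject₁ i)) (vtx (suc i))

  Connected : Set
  Connected = ∀ u v → Σ[ k ∈ ℕ ] Σ[ w ∈ Walk k ]
                (Walk.vtx w zero ≡ u × Walk.vtx w (fromℕ k) ≡ v)

  record Cycle : Set where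
    field
      len-1   : ℕ
      len≥3   : 2 ≤ len-1
      vtx     : Fin (suc len-1) → V
      inj     : ∀ i j → vtx i ≡ vtx j → i ≡ j
      steps   : ∀ (i : Fin len-1) → E (vtx (inject₁ i)) (vtx (suc i))
      closing : E (vtx (fromℕ len-1)) (vtx zero)

  CycleStep : Cycle → V → V → Set
  CycleStep C a b =
    (Σ[ i ∈ Fin (Cycle.len-1 C) ]
       (Cycle.vtx C (inject₁ i) ≡ a × Cycle.vtx C (suc i) ≡ b))
    ⊎ (Cycle.vtx C (fromℕ (Cycle.len-1 C)) ≡ a × Cycle.vtx C zero ≡ b)

  CycleEdge : Cycle → V → V → Set
  CycleEdge C a b = CycleStep C a b ⊎ CycleStep C b a

  -- Exactly one cycle (as a subgraph, i.e. up to its edge set).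
  ExactlyOneCycle : Set
  ExactlyOneCycle = Σ[ C ∈ Cycle ] (∀ (D : Cycle) → ∀ a b → CycleEdge C a b ⇔ CycleEdge D a b)

  Unicyclic : Set
  Unicyclic = Connected × ExactlyOneCycle

  Acyclic : Set
  Acyclic = ¬ Cycle

  IsTree : Set
  IsTree = Connected × Acyclic

  record BiInfPath : Set where
    field
      vtx   : ℤ → V
      inj   : ∀ x y → vtx x ≡ vtx y → x ≡ y
      steps : ∀ z → E (vtx z) (vtx (z + 1ℤ))

  PathEdge : BiInfPath → V → V → Set
  PathEdge P a b = Σ[ z ∈ ℤ ]
      ((BiInfPath.vtx P z ≡ a × BiInfPath.vtx P (z + 1ℤ) ≡ b)
     ⊎ (BiInfPath.vtx P z ≡ b × BiInfPath.vtx P (z + 1ℤ) ≡ a))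

  -- Exactly one two-way infinite path subgraph (paths compared by edge set).
  ExactlyOneBiInfPath : Set
  ExactlyOneBiInfPath =
    Σ[ P ∈ BiInfPath ] (∀ (Q : BiInfPath) → ∀ a b → PathEdge P a b ⇔ PathEdge Q a b)

record CoveringMap {VK VG : Set} (K : Graph VK) (G : Graph VG) (φ : VK → VG) : Set where
  field
    surj     : ∀ y → ∃[ x ] φ x ≡ y
    hom      : ∀ u v → E K u v → E G (φ u) (φ v)
    nbhd-inj : ∀ v u u' → E K v u → E K v u' → φ u ≡ φ u' → u ≡ u'
    nbhd-surj : ∀ v w → E G (φ v) w → Σ[ u ∈ VK ] (E K v u × φ u ≡ w)

record UniversalCover {VG : Set} (G : Graph VG) : Set₁ where
  field
    V    : Set
    U    : Graph V
    tree : IsTree U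
    φ    : V → VG
    cov  : CoveringMap U G φ

module Submission where

-- Lifting the winding around a cycle of G gives a bi-infinite path in the tree U.
-- If G is unicyclic, a non-backtracking ray in G that starts on the cycle runs along it:
-- its first self-intersection closes a cycle, which must be the cycle. Lifting this,
-- a non-backtracking ray in U that starts on the lift P of the cycle follows P. Every
-- vertex of another bi-infinite path Q is reached from P by such a ray (a reduced walk
-- from P, continued along Q), so Q and P have the same vertices and then the same edges.
-- Conversely, the projection of the unique bi-infinite path of U is a non-backtracking
-- ray in the finite graph G, so G has a cycle; each cycle is the projection of its lift,
-- and all lifts have the edges of the unique path, so all cycles have the same edges.

open import Defs
open import Data.Nat using (ℕ; zero; suc; _≤_; _<_; z≤n; s≤s) renaming (_+_ to _+ℕ_)
import Data.Nat.Properties as ℕ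
open import Data.Nat.Induction using (<-rec)
open import Data.Fin using (Fin; zero; suc; toℕ; inject₁; fromℕ)
import Data.Fin.Properties as Fin
open import Data.Fin.Relation.Unary.Top using (View; ‵fromℕ; ‵inj₁; view; view-fromℕ; view-inject₁)
open import Data.Integer using (ℤ; +_; -[1+_]; 1ℤ; -_; _-_) renaming (_+_ to _+ℤ_)
import Data.Integer.Properties as ℤ
open import Data.Integer.Tactic.RingSolver using (solve-∀)
open import Data.Unit using (⊤; tt)
open import Data.Empty using (⊥-elim)
open import Data.Product using (Σ; Σ-syntax; ∃; _×_; _,_; proj₁; proj₂)
open import Data.Sum using (_⊎_; inj₁; inj₂; swap)
import Data.Sum as Sum
open import Function using (_∘_; _⇔_; mk⇔; Equivalence)
open import Relation.Binary.Construct.Closure.ReflexiveTransitive using (Star; ε; _◅_)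
open import Relation.Binary.Definitions using (tri<; tri≈; tri>; DecidableEquality)
open import Relation.Binary.PropositionalEquality
open import Relation.Nullary using (¬_; Dec; yes; no; contradiction)

NonBacktracking : {A : Set} → (ℕ → A) → Set
NonBacktracking f = ∀ t → f t ≢ f (suc (suc t))

infixr 5 _∷_

_∷_ : {A : Set} → A → (ℕ → A) → ℕ → A
(a ∷ f) zero    = a
(a ∷ f) (suc t) = f t

∷-nonBacktracking : {A : Set} {a : A} {f : ℕ → A} →
                    a ≢ f 1 → NonBacktracking f → NonBacktracking (a ∷ f)
∷-nonBacktracking a≢f₁ nb zero    = a≢f₁
∷-nonBacktracking a≢f₁ nb (suc t) = nb t

<⇒≡suc+ : ∀ {a b} → a < b → ∃ λ d → b ≡ suc d +ℕ a
<⇒≡suc+ {a} a<b with ℕ.m≤n⇒∃[o]m+o≡n a<b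
... | d , eq = d , trans (sym eq) (cong suc (ℕ.+-comm a d))

module _ {V : Set} {_~_ : V → V → Set} where

  Chain : (ℕ → V) → Set
  Chain f = ∀ t → f t ~ f (suc t)

  NonBacktrackingWalk : ∀ {u v} → Star _~_ u v → Set
  NonBacktrackingWalk ε                                   = ⊤
  NonBacktrackingWalk (e ◅ ε)                             = ⊤
  NonBacktrackingWalk (_◅_ {i = u} e (_◅_ {j = w} e′ p)) = u ≢ w × NonBacktrackingWalk (e′ ◅ p)

  _▸_ : ∀ {u v} → Star _~_ u v → (ℕ → V) → ℕ → V
  ε                 ▸ ρ = ρ
  (_◅_ {i = u} e p) ▸ ρ = u ∷ (p ▸ ρ)

  module _ {v : V} {ρ : ℕ → V} (ρ₀ : ρ 0 ≡ v) where

    ▸-head : ∀ {u} (p : Star _~_ u v) → (p ▸ ρ) 0 ≡ u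
    ▸-head ε       = ρ₀
    ▸-head (e ◅ p) = refl

    ▸-ray : Chain ρ → ∀ {u} (p : Star _~_ u v) → Chain (p ▸ ρ)
    ▸-ray ray ε       = ray
    ▸-ray ray (e ◅ p) zero    = subst (_ ~_) (sym (▸-head p)) e
    ▸-ray ray (e ◅ p) (suc t) = ▸-ray ray p t

  module _ (backtrack? : ∀ {u v w} → u ~ v → v ~ w → Dec (u ≡ w)) where

    reduce : ∀ {u v} → Star _~_ u v → Σ (Star _~_ u v) NonBacktrackingWalk
    reduce ε       = ε , tt
    reduce (e ◅ p) = push e (proj₁ (reduce p)) (proj₂ (reduce p))
      where
        tail : ∀ {u v w} (e : u ~ v) (p : Star _~_ v w) →
               NonBacktrackingWalk (e ◅ p) → NonBacktrackingWalk p
        tail e ε        _        = tt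
        tail e (e′ ◅ p) (_ , nb) = nb

        push : ∀ {u v w} → u ~ v → (p : Star _~_ v w) → NonBacktrackingWalk p →
               Σ (Star _~_ u w) NonBacktrackingWalk
        push e ε        _  = e ◅ ε , tt
        push e (e′ ◅ p) nb with backtrack? e e′
        ... | yes refl = p , tail e′ p nb
        ... | no u≢w   = e ◅ e′ ◅ p , u≢w , nb

    ▸-nonBacktracking : ∀ {v} {ρ σ : ℕ → V} → ρ 0 ≡ v → σ 0 ≡ v → Chain ρ → Chain σ →
                        NonBacktracking ρ → NonBacktracking σ → ρ 1 ≢ σ 1 →
                        ∀ {u} (p : Star _~_ u v) → NonBacktrackingWalk p →
                        NonBacktracking (p ▸ ρ) ⊎ NonBacktracking (p ▸ σ)
    ▸-nonBacktracking ρ₀ σ₀ rρ rσ nbρ nbσ ρ₁≢σ₁ ε _ = inj₁ nbρ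
    ▸-nonBacktracking ρ₀ σ₀ rρ rσ nbρ nbσ ρ₁≢σ₁ (e ◅ ε) _
      with backtrack? e (subst (λ x → x ~ _) ρ₀ (rρ 0))
    ... | yes refl = inj₂ (∷-nonBacktracking ρ₁≢σ₁ nbσ)
    ... | no u≢ρ₁  = inj₁ (∷-nonBacktracking u≢ρ₁ nbρ)
    ▸-nonBacktracking ρ₀ σ₀ rρ rσ nbρ nbσ ρ₁≢σ₁ (e ◅ e′ ◅ p) (u≢w , nb) =
      Sum.map (∷-nonBacktracking (λ q → u≢w (trans q (▸-head ρ₀ p))))
              (∷-nonBacktracking (λ q → u≢w (trans q (▸-head σ₀ p))))
              (▸-nonBacktracking ρ₀ σ₀ rρ rσ nbρ nbσ ρ₁≢σ₁ (e′ ◅ p) nb)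

-- Iterated successor and predecessor, so that rays along a bi-infinite walk step
-- without any integer arithmetic.
_+ₙ_ : ℤ → ℕ → ℤ
x +ₙ zero  = x
x +ₙ suc t = (x +ₙ t) +ℤ 1ℤ

_-ₙ_ : ℤ → ℕ → ℤ
x -ₙ zero  = x
x -ₙ suc t = (x -ₙ t) - 1ℤ

+ₙ-correct : ∀ x t → x +ₙ t ≡ x +ℤ + t
+ₙ-correct x zero    = sym (ℤ.+-identityʳ x)
+ₙ-correct x (suc t) = trans (cong (_+ℤ 1ℤ) (+ₙ-correct x t)) (sym (+suc x (+ t)))
  where
    +suc : ∀ x y → x +ℤ (1ℤ +ℤ y) ≡ x +ℤ y +ℤ 1ℤ
    +suc = solve-∀

-ₙ-correct : ∀ x t → x -ₙ t ≡ x - + t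
-ₙ-correct x zero    = sym (ℤ.+-identityʳ x)
-ₙ-correct x (suc t) = trans (cong (_- 1ℤ) (-ₙ-correct x t)) (sym (-suc x (+ t)))
  where
    -suc : ∀ x y → x - (1ℤ +ℤ y) ≡ x - y - 1ℤ
    -suc = solve-∀

-difference : ∀ x y → x - y ≡ - (y - x)
-difference = solve-∀

-1+1 : ∀ z → z - 1ℤ +ℤ 1ℤ ≡ z
-1+1 = solve-∀

≡+difference : ∀ x y → y ≡ x +ℤ (y - x)
≡+difference = solve-∀

≢-by-difference : ∀ {x y} k → y - x ≡ + suc k → x ≢ y
≢-by-difference {x} k d refl = contradiction (trans (sym (ℤ.+-inverseʳ x)) d) λ ()

≢+1+1 : ∀ z → z ≢ z +ℤ 1ℤ +ℤ 1ℤ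
≢+1+1 z = ≢-by-difference 1 (difference z)
  where
    difference : ∀ z → z +ℤ 1ℤ +ℤ 1ℤ - z ≡ 1ℤ +ℤ 1ℤ
    difference = solve-∀

-1≢+1 : ∀ z → z - 1ℤ ≢ z +ℤ 1ℤ
-1≢+1 z = ≢-by-difference 1 (difference z)
  where
    difference : ∀ z → z +ℤ 1ℤ - (z - 1ℤ) ≡ 1ℤ +ℤ 1ℤ
    difference = solve-∀

module _ {V : Set} (G : Graph V) where

  Ray : (ℕ → V) → Set
  Ray = Chain {_~_ = E G}

  BiInfWalk : (ℤ → V) → Set
  BiInfWalk L = ∀ z → E G (L z) (L (z +ℤ 1ℤ))

  OnCycle : Cycle G → V → Set
  OnCycle C x = Σ[ i ∈ Fin (suc (Cycle.len-1 C)) ] Cycle.vtx C i ≡ x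

  module _ {f : ℕ → V} (ray : Ray f) (nb : NonBacktracking f) where

    return-length : ∀ a L → f (suc L +ℕ a) ≡ f a → 2 ≤ L
    return-length a zero          ret = ⊥-elim (adj-irr G (f a) (subst (E G (f a)) ret (ray a)))
    return-length a (suc zero)    ret = ⊥-elim (nb a (sym ret))
    return-length a (suc (suc L)) ret = s≤s (s≤s z≤n)

    returnCycle : ∀ a L → f (suc L +ℕ a) ≡ f a →
                  (∀ i d → suc d +ℕ i ≤ L → f (suc d +ℕ (i +ℕ a)) ≢ f (i +ℕ a)) → Cycle G
    returnCycle a L ret no-return = record
      { len-1   = L
      ; len≥3   = return-length a L ret
      ; vtx     = λ i → f (toℕ i +ℕ a)
      ; inj     = injective
      ; steps   = λ i → subst (λ k → E G (f (k +ℕ a)) (f (suc (toℕ i) +ℕ a)))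
                              (sym (Fin.toℕ-inject₁ i)) (ray (toℕ i +ℕ a))
      ; closing = subst (λ k → E G (f (k +ℕ a)) (f a)) (sym (Fin.toℕ-fromℕ L))
                        (subst (E G (f (L +ℕ a))) ret (ray (L +ℕ a)))
      }
      where
        no-repeat : ∀ (i j : Fin (suc L)) → toℕ i < toℕ j → f (toℕ i +ℕ a) ≢ f (toℕ j +ℕ a)
        no-repeat i j i<j e with <⇒≡suc+ i<j
        ... | d , j≡ = no-return (toℕ i) d (subst (_≤ L) j≡ (ℕ.≤-pred (Fin.toℕ<n j)))
                         (trans (cong f (trans (sym (ℕ.+-assoc (suc d) (toℕ i) a))
                                               (cong (_+ℕ a) (sym j≡))))
                                (sym e))

        injective : ∀ i j → f (toℕ i +ℕ a) ≡ f (toℕ j +ℕ a) → i ≡ j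
        injective i j e with Fin.<-cmp i j
        ... | tri< i<j _ _ = contradiction e (no-repeat i j i<j)
        ... | tri≈ _ i≡j _ = i≡j
        ... | tri> _ _ j<i = contradiction (sym e) (no-repeat j i j<i)

    returnCycle-firstStep : ∀ a L ret no-return →
                            CycleStep G (returnCycle a L ret no-return) (f a) (f (suc a))
    returnCycle-firstStep a (suc L) ret no-return = inj₁ (zero , refl , refl)
    returnCycle-firstStep a zero    ret no-return = ⊥-elim (ℕ.≤⇒≯ (return-length a 0 ret) (s≤s z≤n))

    module _ (acyclic : Acyclic G) where

      -- A return with no shorter return inside it traces a cycle.
      acyclic-no-return : ∀ d a → f (suc d +ℕ a) ≢ f a
      acyclic-no-return = <-rec (λ d → ∀ a → f (suc d +ℕ a) ≢ f a) λ d rec a ret →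
        acyclic (returnCycle a d ret λ i d′ bound → rec (ℕ.≤-trans (ℕ.m≤m+n (suc d′) i) bound) (i +ℕ a))

      acyclic-ray-injective : ∀ i j → f i ≡ f j → i ≡ j
      acyclic-ray-injective i j e with ℕ.<-cmp i j
      ... | tri< i<j _ _ = contradiction (trans (cong f (sym (proj₂ (<⇒≡suc+ i<j)))) (sym e))
                                         (acyclic-no-return _ i)
      ... | tri≈ _ i≡j _ = i≡j
      ... | tri> _ _ j<i = contradiction (trans (cong f (sym (proj₂ (<⇒≡suc+ j<i)))) e)
                                         (acyclic-no-return _ j)

  NonBacktrackingℤ : (ℤ → V) → Set
  NonBacktrackingℤ L = ∀ z → L z ≢ L (z +ℤ 1ℤ +ℤ 1ℤ)

  forwardRay : (ℤ → V) → ℤ → ℕ → V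
  forwardRay L x t = L (x +ₙ t)

  backwardRay : (ℤ → V) → ℤ → ℕ → V
  backwardRay L x t = L (x -ₙ t)

  module _ {L : ℤ → V} (x : ℤ) where

    forwardRay-ray : BiInfWalk L → Ray (forwardRay L x)
    forwardRay-ray walk t = walk (x +ₙ t)

    forwardRay-nonBacktracking : NonBacktrackingℤ L → NonBacktracking (forwardRay L x)
    forwardRay-nonBacktracking nb t = nb (x +ₙ t)

    backwardRay-ray : BiInfWalk L → Ray (backwardRay L x)
    backwardRay-ray walk t =
      adj-sym G _ _ (subst (E G (L (x -ₙ suc t)) ∘ L) (-1+1 (x -ₙ t)) (walk (x -ₙ suc t)))

    backwardRay-nonBacktracking : NonBacktrackingℤ L → NonBacktracking (backwardRay L x)
    backwardRay-nonBacktracking nb t e = nb (x -ₙ suc (suc t)) (trans (sym e) (cong L (sym back)))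
      where
        back : x -ₙ suc (suc t) +ℤ 1ℤ +ℤ 1ℤ ≡ x -ₙ t
        back = trans (cong (_+ℤ 1ℤ) (-1+1 (x -ₙ suc t))) (-1+1 (x -ₙ t))

  module _ (acyclic : Acyclic G) {L : ℤ → V} (walk : BiInfWalk L) (nb : NonBacktrackingℤ L) where

    acyclic-biInfWalk-no-return : ∀ x d → L x ≡ L (x +ℤ + d) → d ≡ 0
    acyclic-biInfWalk-no-return x d e =
      sym (acyclic-ray-injective (forwardRay-ray x walk) (forwardRay-nonBacktracking x nb)
                                 acyclic 0 d (trans e (cong L (sym (+ₙ-correct x d)))))

    acyclic-biInfWalk-injective : ∀ x y → L x ≡ L y → x ≡ y
    acyclic-biInfWalk-injective x y e with y - x in y-x
    ... | + d      = sym (trans y≡ (trans (cong (λ k → x +ℤ + k)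
                                                (acyclic-biInfWalk-no-return x d (trans e (cong L y≡))))
                                          (ℤ.+-identityʳ x)))
      where
        y≡ : y ≡ x +ℤ + d
        y≡ = trans (≡+difference x y) (cong (x +ℤ_) y-x)
    ... | -[1+ d ] = contradiction (acyclic-biInfWalk-no-return y (suc d) (trans (sym e) (cong L x≡))) λ ()
      where
        x≡ : x ≡ y +ℤ + suc d
        x≡ = trans (≡+difference y x) (cong (y +ℤ_) (trans (-difference x y) (cong -_ y-x)))

  glue : (ℕ → V) → (ℕ → V) → ℤ → V
  glue b f (+ t)     = f t
  glue b f -[1+ t ] = b (suc t)

  glue-biInfWalk : ∀ {b f} → Ray b → Ray f → b 0 ≡ f 0 → BiInfWalk (glue b f)
  glue-biInfWalk {f = f} rb rf b₀ (+ t) = subst (E G (f t) ∘ f) (ℕ.+-comm 1 t) (rf t)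
  glue-biInfWalk rb rf b₀ -[1+ zero ]  = subst (E G _) b₀ (adj-sym G _ _ (rb 0))
  glue-biInfWalk rb rf b₀ -[1+ suc t ] = adj-sym G _ _ (rb (suc t))

  walk-star : ∀ k (w : Walk G k) → Star (E G) (Walk.vtx w zero) (Walk.vtx w (fromℕ k))
  walk-star zero    w = ε
  walk-star (suc k) w =
    Walk.steps w zero ◅ walk-star k (record { vtx = Walk.vtx w ∘ suc ; steps = Walk.steps w ∘ suc })

  connected-star : Connected G → ∀ u v → Star (E G) u v
  connected-star conn u v with conn u v
  ... | k , w , refl , refl = walk-star k w

module _ {M : ℕ} where

  next-view : {i : Fin (suc M)} → View i → Fin (suc M)
  next-view ‵fromℕ             = zero
  next-view (‵inj₁ {i = j} _) = suc j

  next : Fin (suc M) → Fin (suc M)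
  next i = next-view (view i)

  prev : Fin (suc M) → Fin (suc M)
  prev zero    = fromℕ M
  prev (suc j) = inject₁ j

  next-fromℕ : next (fromℕ M) ≡ zero
  next-fromℕ = cong next-view (view-fromℕ M)

  next-inject₁ : ∀ j → next (inject₁ j) ≡ suc j
  next-inject₁ j = cong next-view (view-inject₁ j)

  next-prev : ∀ i → next (prev i) ≡ i
  next-prev zero    = next-fromℕ
  next-prev (suc j) = next-inject₁ j

  prev-next : ∀ i → prev (next i) ≡ i
  prev-next i = prev-next-view (view i)
    where
      prev-next-view : ∀ {i} (v : View i) → prev (next-view v) ≡ i
      prev-next-view ‵fromℕ    = refl
      prev-next-view (‵inj₁ _) = refl

  toℕ-next : ∀ i → toℕ i < M → toℕ (next i) ≡ suc (toℕ i)
  toℕ-next i = toℕ-next-view (view i)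
    where
      toℕ-next-view : ∀ {i} (v : View i) → toℕ i < M → toℕ (next-view v) ≡ suc (toℕ i)
      toℕ-next-view ‵fromℕ             M<M =
        contradiction (subst (_< M) (Fin.toℕ-fromℕ M) M<M) (ℕ.<-irrefl refl)
      toℕ-next-view (‵inj₁ {i = j} _) _   = cong suc (sym (Fin.toℕ-inject₁ j))

  toℕ≡M⇒next≡zero : ∀ i → toℕ i ≡ M → next i ≡ zero
  toℕ≡M⇒next≡zero i eq =
    trans (cong next (Fin.toℕ-injective (trans eq (sym (Fin.toℕ-fromℕ M))))) next-fromℕ

  next-cases : ∀ i → (toℕ (next i) ≡ suc (toℕ i)) ⊎ (toℕ i ≡ M × next i ≡ zero)
  next-cases i with toℕ i ℕ.<? M
  ... | yes i<M = inj₁ (toℕ-next i i<M)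
  ... | no  i≮M = inj₂ (i≡M , toℕ≡M⇒next≡zero i i≡M)
    where
      i≡M : toℕ i ≡ M
      i≡M = ℕ.≤-antisym (ℕ.≤-pred (Fin.toℕ<n i)) (ℕ.≮⇒≥ i≮M)

  next-next≢ : 1 < M → ∀ i → next (next i) ≢ i
  next-next≢ 1<M i e with next-cases i | next-cases (next i)
  ... | inj₁ n | inj₁ nn        = ℕ.m≢1+n+m (toℕ i) (trans (cong toℕ (sym e)) (trans nn (cong suc n)))
  ... | inj₁ n | inj₂ (n≡M , nn) = ℕ.<⇒≢ 1<M (trans (sym (trans n (cong (suc ∘ toℕ) i≡0))) n≡M)
    where
      i≡0 : i ≡ zero
      i≡0 = trans (sym e) nn
  ... | inj₂ (i≡M , n) | inj₁ nn =
    ℕ.<⇒≢ 1<M (trans (sym (trans nn (cong (suc ∘ toℕ) n))) (trans (cong toℕ e) i≡M))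
  ... | inj₂ (i≡M , n) | inj₂ (n≡M , _) =
    ℕ.<⇒≢ (ℕ.<-trans (s≤s z≤n) 1<M) (trans (sym (cong toℕ n)) n≡M)

  windIndex : ℤ → Fin (suc M)
  windIndex (+ zero)      = zero
  windIndex (+ suc k)     = next (windIndex (+ k))
  windIndex -[1+ zero ]  = prev zero
  windIndex -[1+ suc k ] = prev (windIndex -[1+ k ])

  windIndex-suc : ∀ z → windIndex (z +ℤ 1ℤ) ≡ next (windIndex z)
  windIndex-suc (+ k)       = cong (windIndex ∘ +_) (ℕ.+-comm k 1)
  windIndex-suc -[1+ zero ]  = sym (next-prev zero)
  windIndex-suc -[1+ suc k ] = sym (next-prev (windIndex -[1+ k ]))

  windIndex-toℕ : ∀ i → windIndex (+ toℕ i) ≡ i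
  windIndex-toℕ i = Fin.toℕ-injective (toℕ-windIndex (toℕ i) (ℕ.≤-pred (Fin.toℕ<n i)))
    where
      toℕ-windIndex : ∀ k → k ≤ M → toℕ (windIndex (+ k)) ≡ k
      toℕ-windIndex zero    _   = refl
      toℕ-windIndex (suc k) k<M = trans (toℕ-next _ (subst (_< M) (sym IH) k<M)) (cong suc IH)
        where
          IH : toℕ (windIndex (+ k)) ≡ k
          IH = toℕ-windIndex k (ℕ.<⇒≤ k<M)

among-two : {A : Set} {p q y y₁ y₂ : A} → y ≡ p ⊎ y ≡ q → y₁ ≡ p ⊎ y₁ ≡ q → y₂ ≡ p ⊎ y₂ ≡ q →
            y₁ ≢ y₂ → y ≡ y₁ ⊎ y ≡ y₂
among-two (inj₁ refl) (inj₁ refl) _           _  = inj₁ refl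
among-two (inj₁ refl) (inj₂ refl) (inj₁ refl) _  = inj₂ refl
among-two (inj₁ refl) (inj₂ refl) (inj₂ refl) ne = contradiction refl ne
among-two (inj₂ refl) (inj₂ refl) _           _  = inj₁ refl
among-two (inj₂ refl) (inj₁ refl) (inj₂ refl) _  = inj₂ refl
among-two (inj₂ refl) (inj₁ refl) (inj₁ refl) ne = contradiction refl ne

-- A cycle as a bi-infinite walk

module _ {V : Set} {G : Graph V} (C : Cycle G) where
  open Cycle C

  cycleStep-next : ∀ i → CycleStep G C (vtx i) (vtx (next i))
  cycleStep-next i with view i
  ... | ‵fromℕ             = inj₂ (refl , refl)
  ... | ‵inj₁ {i = j} _ = inj₁ (j , refl , refl)

  cycleStep-index : ∀ {x y} → CycleStep G C x y → Σ[ i ∈ Fin (suc len-1) ] vtx i ≡ x × vtx (next i) ≡ y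
  cycleStep-index (inj₁ (k , x≡ , y≡)) = inject₁ k , x≡ , trans (cong vtx (next-inject₁ k)) y≡
  cycleStep-index (inj₂ (x≡ , y≡))     = fromℕ len-1 , x≡ , trans (cong vtx next-fromℕ) y≡

  cycleStep-edge : ∀ {x y} → CycleStep G C x y → E G x y
  cycleStep-edge (inj₁ (k , refl , refl)) = steps k
  cycleStep-edge (inj₂ (refl , refl))     = closing

  cycleEdge-onCycle : ∀ {x y} → CycleEdge G C x y → OnCycle G C x
  cycleEdge-onCycle (inj₁ s) with cycleStep-index s
  ... | i , x≡ , _ = i , x≡
  cycleEdge-onCycle (inj₂ s) with cycleStep-index s
  ... | i , _ , x≡ = next i , x≡

  cycleEdge-neighbour : ∀ i {y} → CycleEdge G C (vtx i) y → y ≡ vtx (prev i) ⊎ y ≡ vtx (next i)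
  cycleEdge-neighbour i (inj₁ s) with cycleStep-index s
  ... | k , k≡ , y≡ = inj₂ (trans (sym y≡) (cong (vtx ∘ next) (inj k i k≡)))
  cycleEdge-neighbour i (inj₂ s) with cycleStep-index s
  ... | k , y≡ , k′≡ =
    inj₁ (trans (sym y≡) (cong vtx (trans (sym (prev-next k)) (cong prev (inj _ i k′≡)))))

  cycleEdge-third : ∀ {x y y₁ y₂} → CycleEdge G C x y → CycleEdge G C x y₁ → CycleEdge G C x y₂ →
                    y₁ ≢ y₂ → y ≡ y₁ ⊎ y ≡ y₂
  cycleEdge-third e e₁ e₂ with cycleEdge-onCycle e
  ... | i , refl = among-two (cycleEdge-neighbour i e) (cycleEdge-neighbour i e₁) (cycleEdge-neighbour i e₂)

  wind : ℤ → V
  wind z = vtx (windIndex z)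

  wind-step : ∀ z → CycleStep G C (wind z) (wind (z +ℤ 1ℤ))
  wind-step z = subst (CycleStep G C (wind z) ∘ vtx) (sym (windIndex-suc z)) (cycleStep-next (windIndex z))

  wind-biInfWalk : BiInfWalk G wind
  wind-biInfWalk = cycleStep-edge ∘ wind-step

  wind-nonBacktracking : NonBacktrackingℤ G wind
  wind-nonBacktracking z e = next-next≢ len≥3 (windIndex z) (sym (inj _ _ (trans e (cong vtx around))))
    where
      around : windIndex (z +ℤ 1ℤ +ℤ 1ℤ) ≡ next (next (windIndex z))
      around = trans (windIndex-suc (z +ℤ 1ℤ)) (cong next (windIndex-suc z))

  cycleStep-wind : ∀ {x y} → CycleStep G C x y → Σ[ z ∈ ℤ ] wind z ≡ x × wind (z +ℤ 1ℤ) ≡ y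
  cycleStep-wind s with cycleStep-index s
  ... | i , x≡ , y≡ = + toℕ i , trans (cong vtx (windIndex-toℕ i)) x≡
                              , trans (cong vtx (trans (windIndex-suc (+ toℕ i)) (cong next (windIndex-toℕ i)))) y≡

-- Sequences in a finite set, and the cycles they trace

module _ {n : ℕ} (f : ℕ → Fin n) where

  record FirstReturn : Set where
    field
      base length : ℕ
      returns     : f (suc length +ℕ base) ≡ f base
      earlier     : ∀ i d → suc d +ℕ i ≤ length +ℕ base → f (suc d +ℕ i) ≢ f i

  private
    Repeats : ℕ → Set
    Repeats b = ∃ λ a → a < b × f a ≡ f b

    repeats? : ∀ b → Dec (Repeats b)
    repeats? b = ℕ.anyUpTo? (λ a → f a Fin.≟ f b) b

    fromMinimal : ∀ b → Repeats b → ¬ (∃ λ b′ → b′ < b × Repeats b′) → FirstReturn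
    fromMinimal b (a , a<b , fa≡fb) none with <⇒≡suc+ a<b
    ... | d , refl = record
      { base    = a
      ; length  = d
      ; returns = sym fa≡fb
      ; earlier = λ i d′ bound e → none (suc d′ +ℕ i , s≤s bound , i , s≤s (ℕ.m≤n+m i d′) , sym e)
      }

    minimalReturn : ∀ b → Repeats b → FirstReturn
    minimalReturn = <-rec (λ b → Repeats b → FirstReturn) λ b rec r → descend b rec r
      where
        descend : ∀ b → (∀ {b′} → b′ < b → Repeats b′ → FirstReturn) → Repeats b → FirstReturn
        descend b rec r with ℕ.anyUpTo? repeats? b
        ... | yes (b′ , b′<b , r′) = rec b′<b r′
        ... | no none              = fromMinimal b r none

  firstReturn : FirstReturn
  firstReturn with Fin.pigeonhole (ℕ.n<1+n n) (f ∘ toℕ)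
  ... | i , j , i<j , e = minimalReturn (toℕ j) (toℕ i , i<j , e)

module _ {n : ℕ} (G : Graph (Fin n)) {f : ℕ → Fin n} (ray : Ray G f) (nb : NonBacktracking f) where
  open FirstReturn (firstReturn f)

  private
    no-earlier-return : ∀ i d → suc d +ℕ i ≤ length → f (suc d +ℕ (i +ℕ base)) ≢ f (i +ℕ base)
    no-earlier-return i d bound =
      earlier (i +ℕ base) d (subst (_≤ length +ℕ base) (ℕ.+-assoc (suc d) i base) (ℕ.+-monoˡ-≤ base bound))

  rayCycle : Cycle G
  rayCycle = returnCycle G ray nb base length returns no-earlier-return

  -- The cycle traced first by a non-backtracking ray in a unicyclic graph is the
  -- cycle; if the ray starts on it, it therefore starts out along it.
  firstStep-onCycle : (C : Cycle G) → (∀ D x y → CycleEdge G C x y ⇔ CycleEdge G D x y) →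
                      OnCycle G C (f 0) → CycleEdge G C (f 0) (f 1)
  firstStep-onCycle C unique (i , i≡) = Equivalence.from (unique rayCycle (f 0) (f 1)) (inj₁ firstStep)
    where
      leaving : CycleStep G C (f 0) (Cycle.vtx C (next i))
      leaving = subst (λ x → CycleStep G C x (Cycle.vtx C (next i))) i≡ (cycleStep-next C i)

      at-start : ∀ m → m ≤ length +ℕ base → f m ≡ f 0 → m ≡ 0
      at-start zero    _     _ = refl
      at-start (suc m) bound e =
        contradiction (trans (cong f (ℕ.+-identityʳ (suc m))) e)
                      (earlier 0 m (subst (_≤ length +ℕ base) (sym (ℕ.+-identityʳ (suc m))) bound))

      base≡0 : base ≡ 0
      base≡0 with cycleEdge-onCycle rayCycle (Equivalence.to (unique rayCycle (f 0) _) (inj₁ leaving))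
      ... | k , fk≡f0 = ℕ.m+n≡0⇒n≡0 (toℕ k) (at-start _ (ℕ.+-monoˡ-≤ base (ℕ.≤-pred (Fin.toℕ<n k))) fk≡f0)

      firstStep : CycleStep G rayCycle (f 0) (f 1)
      firstStep = subst (λ a → CycleStep G rayCycle (f a) (f (suc a))) base≡0
                        (returnCycle-firstStep G ray nb base length returns no-earlier-return)

module _ {VU VG : Set} {U : Graph VU} {G : Graph VG} {φ : VU → VG} (cov : CoveringMap U G φ) where
  open CoveringMap cov

  ray-project : ∀ {c} → Ray U c → Ray G (φ ∘ c)
  ray-project ray t = hom _ _ (ray t)

  nonBacktracking-project : ∀ {c} → Ray U c → NonBacktracking c → NonBacktracking (φ ∘ c)
  nonBacktracking-project ray nb t e = nb t (nbhd-inj _ _ _ (adj-sym U _ _ (ray t)) (ray (suc t)) e)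

  backtrack? : DecidableEquality VG → ∀ {u v w} → E U u v → E U v w → Dec (u ≡ w)
  backtrack? _≟_ {u} {v} {w} e e′ with φ u ≟ φ w
  ... | yes φu≡φw = yes (nbhd-inj v u w (adj-sym U _ _ e) e′ φu≡φw)
  ... | no  φu≢φw = no (φu≢φw ∘ cong φ)

  module _ {ω : ℕ → VG} (ray : Ray G ω) {u : VU} (u↦ω₀ : φ u ≡ ω 0) where

    private
      liftStep : ∀ t v → φ v ≡ ω t → Σ[ w ∈ VU ] E U v w × φ w ≡ ω (suc t)
      liftStep t v v↦ = nbhd-surj v (ω (suc t)) (subst (λ x → E G x (ω (suc t))) (sym v↦) (ray t))

      lift : ∀ t → Σ[ v ∈ VU ] φ v ≡ ω t
      lift zero    = u , u↦ω₀
      lift (suc t) = proj₁ s , proj₂ (proj₂ s)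
        where
          s : Σ[ w ∈ VU ] E U (proj₁ (lift t)) w × φ w ≡ ω (suc t)
          s = liftStep t (proj₁ (lift t)) (proj₂ (lift t))

    liftRay : ℕ → VU
    liftRay = proj₁ ∘ lift

    liftRay-over : ∀ t → φ (liftRay t) ≡ ω t
    liftRay-over = proj₂ ∘ lift

    liftRay-ray : Ray U liftRay
    liftRay-ray t = proj₁ (proj₂ (liftStep t (proj₁ (lift t)) (proj₂ (lift t))))

  module _ {ω : ℤ → VG} (walk : BiInfWalk G ω) where

    private
      u₀ : VU
      u₀ = proj₁ (surj (ω (+ 0)))

      u₀↦ : φ u₀ ≡ ω (+ 0)
      u₀↦ = proj₂ (surj (ω (+ 0)))

    liftBiInfWalk : ℤ → VU
    liftBiInfWalk = glue U (liftRay (backwardRay-ray G (+ 0) walk) u₀↦) (liftRay (forwardRay-ray G (+ 0) walk) u₀↦)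

    liftBiInfWalk-walk : BiInfWalk U liftBiInfWalk
    liftBiInfWalk-walk = glue-biInfWalk U (liftRay-ray (backwardRay-ray G (+ 0) walk) u₀↦)
                                          (liftRay-ray (forwardRay-ray G (+ 0) walk) u₀↦) refl

    liftBiInfWalk-over : ∀ z → φ (liftBiInfWalk z) ≡ ω z
    liftBiInfWalk-over (+ t)     = trans (liftRay-over (forwardRay-ray G (+ 0) walk) u₀↦ t)
                                         (cong ω (+ₙ-correct (+ 0) t))
    liftBiInfWalk-over -[1+ t ] = trans (liftRay-over (backwardRay-ray G (+ 0) walk) u₀↦ (suc t))
                                         (cong ω (-ₙ-correct (+ 0) (suc t)))

module _ {V : Set} {H : Graph V} (P : BiInfPath H) where
  open BiInfPath P

  path-nonBacktracking : NonBacktrackingℤ H vtx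
  path-nonBacktracking z e = ≢+1+1 z (inj _ _ e)

  pathEdge-sym : ∀ {a b} → PathEdge H P a b → PathEdge H P b a
  pathEdge-sym (z , e) = z , swap e

-- The universal cover of a finite graph

module _ {n : ℕ} {G : Graph (Fin n)} (UG : UniversalCover G) where
  open UniversalCover UG
  open CoveringMap cov

  private
    backtrack-U? : ∀ {u v w} → E U u v → E U v w → Dec (u ≡ w)
    backtrack-U? = backtrack? cov Fin._≟_

  module _ (D : Cycle G) where

    private
      over : ∀ z → φ (liftBiInfWalk cov (wind-biInfWalk D) z) ≡ wind D z
      over = liftBiInfWalk-over cov (wind-biInfWalk D)

      walk : BiInfWalk U (liftBiInfWalk cov (wind-biInfWalk D))
      walk = liftBiInfWalk-walk cov (wind-biInfWalk D)

    liftCycle : BiInfPath U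
    liftCycle = record
      { vtx   = liftBiInfWalk cov (wind-biInfWalk D)
      ; inj   = acyclic-biInfWalk-injective U (proj₂ tree) walk nonBacktracking
      ; steps = walk
      }
      where
        nonBacktracking : NonBacktrackingℤ U (liftBiInfWalk cov (wind-biInfWalk D))
        nonBacktracking z e =
          wind-nonBacktracking D z (trans (sym (over z)) (trans (cong φ e) (over (z +ℤ 1ℤ +ℤ 1ℤ))))

    liftCycle-over : ∀ z → φ (BiInfPath.vtx liftCycle z) ≡ wind D z
    liftCycle-over = over

    liftCycle-step : ∀ z → CycleStep G D (φ (BiInfPath.vtx liftCycle z))
                                         (φ (BiInfPath.vtx liftCycle (z +ℤ 1ℤ)))
    liftCycle-step z = subst₂ (CycleStep G D) (sym (over z)) (sym (over (z +ℤ 1ℤ))) (wind-step D z)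

    liftCycle-edge : ∀ {a b} → PathEdge U liftCycle a b → CycleEdge G D (φ a) (φ b)
    liftCycle-edge (z , inj₁ (refl , refl)) = inj₁ (liftCycle-step z)
    liftCycle-edge (z , inj₂ (refl , refl)) = inj₂ (liftCycle-step z)

    cycleEdge-lift : ∀ {x y} → CycleEdge G D x y →
                     Σ[ a ∈ V ] Σ[ b ∈ V ] PathEdge U liftCycle a b × φ a ≡ x × φ b ≡ y
    cycleEdge-lift (inj₁ s) with cycleStep-wind D s
    ... | z , x≡ , y≡ = _ , _ , (z , inj₁ (refl , refl)) , trans (over z) x≡ , trans (over (z +ℤ 1ℤ)) y≡
    cycleEdge-lift (inj₂ s) with cycleStep-wind D s
    ... | z , y≡ , x≡ = _ , _ , (z , inj₂ (refl , refl)) , trans (over (z +ℤ 1ℤ)) x≡ , trans (over z) y≡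

  module _ (C : Cycle G) (unique : ∀ D x y → CycleEdge G C x y ⇔ CycleEdge G D x y) where

    Over : BiInfPath U → Set
    Over R = ∀ z → OnCycle G C (φ (BiInfPath.vtx R z))

    module _ (R : BiInfPath U) (over : Over R) where
      open BiInfPath R renaming (vtx to r)

      private
        firstStep : ∀ {c} → Ray U c → NonBacktracking c → ∀ {z} → c 0 ≡ r z →
                    CycleEdge G C (φ (r z)) (φ (c 1))
        firstStep {c} ray nb {z} c₀≡ =
          subst (λ x → CycleEdge G C x (φ (c 1))) (cong φ c₀≡)
            (firstStep-onCycle G (ray-project cov ray) (nonBacktracking-project cov ray nb) C unique
              (subst (OnCycle G C) (cong φ (sym c₀≡)) (over z)))

      -- Both neighbours of r z along R project to the two neighbours of φ (r z) on C,
      -- so by local injectivity of φ they are the only ways to leave r z without backtracking.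
      continues-along : ∀ {c} → Ray U c → NonBacktracking c → ∀ {z} → c 0 ≡ r z →
                        c 1 ≡ r (z - 1ℤ) ⊎ c 1 ≡ r (z +ℤ 1ℤ)
      continues-along {c} ray nb {z} c₀≡ =
        Sum.map (nbhd-inj (r z) _ _ to-c₁ to-pred) (nbhd-inj (r z) _ _ to-c₁ (steps z))
                (cycleEdge-third C (firstStep ray nb c₀≡) backward forward φ-distinct)
        where
          nbR : NonBacktrackingℤ U r
          nbR = path-nonBacktracking R

          to-c₁ : E U (r z) (c 1)
          to-c₁ = subst (λ x → E U x (c 1)) c₀≡ (ray 0)

          to-pred : E U (r z) (r (z - 1ℤ))
          to-pred = backwardRay-ray U z steps 0

          forward : CycleEdge G C (φ (r z)) (φ (r (z +ℤ 1ℤ)))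
          forward = firstStep (forwardRay-ray U z steps) (forwardRay-nonBacktracking U z nbR) refl

          backward : CycleEdge G C (φ (r z)) (φ (r (z - 1ℤ)))
          backward = firstStep (backwardRay-ray U z steps) (backwardRay-nonBacktracking U z nbR) refl

          φ-distinct : φ (r (z - 1ℤ)) ≢ φ (r (z +ℤ 1ℤ))
          φ-distinct e = -1≢+1 z (inj _ _ (nbhd-inj (r z) _ _ to-pred (steps z) e))

      walk-reaches : ∀ {u v} (p : Star (E U) u v) {ρ} → ρ 0 ≡ v → Ray U ρ → NonBacktracking (p ▸ ρ) →
                     ∀ {z} → u ≡ r z → Σ[ z′ ∈ ℤ ] r z′ ≡ v
      walk-reaches ε       ρ₀ ray nb {z} u≡ = z , sym u≡
      walk-reaches {v = v} (e ◅ p) {ρ} ρ₀ ray nb u≡ =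
        Sum.[ onward , onward ] (continues-along (▸-ray ρ₀ ray (e ◅ p)) nb u≡)
        where
          onward : ∀ {z′} → (p ▸ ρ) 0 ≡ r z′ → Σ[ z ∈ ℤ ] r z ≡ v
          onward c₁≡ = walk-reaches p ρ₀ ray (nb ∘ suc) (trans (sym (▸-head ρ₀ p)) c₁≡)

      -- A reduced walk from R to q j, continued along Q without backtracking,
      -- is a non-backtracking ray that starts on R.
      path-onR : (Q : BiInfPath U) → ∀ j → Σ[ z ∈ ℤ ] r z ≡ BiInfPath.vtx Q j
      path-onR Q j with reduce backtrack-U? (connected-star U (proj₁ tree) (r (+ 0)) (q j))
        where open BiInfPath Q renaming (vtx to q)
      ... | p , nbp =
        Sum.[ (λ nb → walk-reaches p refl (forwardRay-ray U j qsteps) nb refl) ,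
              (λ nb → walk-reaches p refl (backwardRay-ray U j qsteps) nb refl) ]
          (▸-nonBacktracking backtrack-U? refl refl (forwardRay-ray U j qsteps) (backwardRay-ray U j qsteps)
             (forwardRay-nonBacktracking U j nbQ) (backwardRay-nonBacktracking U j nbQ)
             (λ e → -1≢+1 j (sym (qinj _ _ e))) p nbp)
        where
          open BiInfPath Q renaming (vtx to q; steps to qsteps; inj to qinj)
          nbQ : NonBacktrackingℤ U q
          nbQ = path-nonBacktracking Q

      module _ (Q : BiInfPath U) (onR : ∀ j → Σ[ z ∈ ℤ ] r z ≡ BiInfPath.vtx Q j) where
        open BiInfPath Q renaming (vtx to q; steps to qsteps)

        over-onR : Over Q
        over-onR j = subst (OnCycle G C ∘ φ) (proj₂ (onR j)) (over (proj₁ (onR j)))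

        pathStep-onR : ∀ j → PathEdge U R (q j) (q (j +ℤ 1ℤ))
        pathStep-onR j with onR j
        ... | z , rz≡qj with continues-along (forwardRay-ray U j qsteps)
                               (forwardRay-nonBacktracking U j (path-nonBacktracking Q)) (sym rz≡qj)
        ...   | inj₁ q′≡ = z - 1ℤ , inj₂ (sym q′≡ , trans (cong r (-1+1 z)) rz≡qj)
        ...   | inj₂ q′≡ = z , inj₁ (rz≡qj , sym q′≡)

        pathEdge-onR : ∀ {a b} → PathEdge U Q a b → PathEdge U R a b
        pathEdge-onR (j , inj₁ (refl , refl)) = pathStep-onR j
        pathEdge-onR (j , inj₂ (refl , refl)) = pathEdge-sym R (pathStep-onR j)

    unicyclic-exactlyOneBiInfPath : ExactlyOneBiInfPath U
    unicyclic-exactlyOneBiInfPath = P , λ Q a b →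
      mk⇔ (pathEdge-onR Q (overQ Q) P (P-onQ Q)) (pathEdge-onR P overP Q (Q-onP Q))
      where
        P : BiInfPath U
        P = liftCycle C

        overP : Over P
        overP z = windIndex z , sym (liftCycle-over C z)

        Q-onP : ∀ Q j → Σ[ z ∈ ℤ ] BiInfPath.vtx P z ≡ BiInfPath.vtx Q j
        Q-onP = path-onR P overP

        overQ : ∀ Q → Over Q
        overQ Q = over-onR P overP Q (Q-onP Q)

        P-onQ : ∀ Q j → Σ[ z ∈ ℤ ] BiInfPath.vtx Q z ≡ BiInfPath.vtx P j
        P-onQ Q = path-onR Q (overQ Q) P

  module _ (P : BiInfPath U) (unique : ∀ Q a b → PathEdge U P a b ⇔ PathEdge U Q a b) where
    open BiInfPath P renaming (vtx to p)

    projectedCycle : Cycle G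
    projectedCycle = rayCycle G (ray-project cov (forwardRay-ray U (+ 0) steps))
                       (nonBacktracking-project cov (forwardRay-ray U (+ 0) steps)
                         (forwardRay-nonBacktracking U (+ 0) (path-nonBacktracking P)))

    -- Every cycle of G is the image of its lift, and all lifts have the edges of P.
    cycleEdge-transfer : ∀ D D′ {x y} → CycleEdge G D x y → CycleEdge G D′ x y
    cycleEdge-transfer D D′ e with cycleEdge-lift D e
    ... | a , b , ab , refl , refl =
      liftCycle-edge D′ (Equivalence.to (unique (liftCycle D′) a b)
                          (Equivalence.from (unique (liftCycle D) a b) ab))

    exactlyOneBiInfPath-exactlyOneCycle : ExactlyOneCycle G
    exactlyOneBiInfPath-exactlyOneCycle =
      projectedCycle , λ D x y → mk⇔ (cycleEdge-transfer projectedCycle D) (cycleEdge-transfer D projectedCycle)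

claim1 : ∀ (n : ℕ) (G : Graph (Fin n)) → Connected G →
         ∀ (UG : UniversalCover G) →
         (Unicyclic G ⇔ ExactlyOneBiInfPath (UniversalCover.U UG))
claim1 n G connected UG = mk⇔
  (λ (_ , C , unique) → unicyclic-exactlyOneBiInfPath UG C unique)
  (λ (P , unique) → connected , exactlyOneBiInfPath-exactlyOneCycle UG P unique)
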